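{- Let $G=(V,E)$ be a finite simple undirected graph with $\Lambda>0$. Fix any centered 3-path $P$ of $G$. Then the probability that the procedure $\mathtt{sample\text{ - }centered}$ outputs (the edge set of) $P$ is exactly $1/\Lambda$.
   Context: Each vertex $v$ has degree $d_v$, neighbour set $N(v)$, and a distinct integer id. Define $u\prec v$ iff $d_u<d_v$, or $d_u=d_v$ and the id of $u$ is less than that of $v$. A 3-path is a set of three edges $\{(t,u),(u,v),(v,w)\}$ with $t,u,v,w$ distinct; it is centered if $v\prec t$, $u\prec w$, and $(t,w)\in E$. For adjacent $u,v$, let $L_{u,v}=|\{x\in N(u): v\prec x\}|$. For each edge $e=(u,v)$ let $\lambda_e=L_{u,v}L_{v,u}$, and $\Lambda=\sum_{e\in E}\lambda_e$. Procedure $\mathtt{sample\text{ - }centered}$: pick an edge $e=(u,v)$ with probability $\lambda_e/\Lambda$; pick $u'$ uniformly at random from $\{x\in N(u): v\prec x\}$ and independently $v'$ uniformly at random from $\{x\in N(v): u\prec x\}$; output $\{(u',u),(u,v),(v,v')\}$. -}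

module Defs where

open import Data.Bool using (Bool; true; false; _∧_; _∨_; if_then_else_)
open import Data.Nat using (ℕ; zero; suc; _+_; _*_; _<ᵇ_; _≡ᵇ_)
open import Data.Fin using (Fin; toℕ) renaming (zero to fzero; suc to fsuc)
open import Data.Integer using (+_)
open import Data.Rational using (ℚ; _/_) renaming (_+_ to _+q_; _*_ to _*q_; 0ℚ to 0q)
open import Data.Product using (_×_; _,_)
open import Relation.Binary.PropositionalEquality using (_≡_; _≢_)

-- A finite simple undirected graph on vertex set Fin n; the id of a vertex is its index.
record Graph (n : ℕ) : Set where
  field
    adj    : Fin n → Fin n → Bool
    adj-sym    : ∀ x y → adj x y ≡ adj y x
    adj-irrefl : ∀ x → adj x x ≡ false
open Graph public

sumℕ : ∀ {n} → (Fin n → ℕ) → ℕ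
sumℕ {zero}  f = 0
sumℕ {suc n} f = f fzero + sumℕ (λ i → f (fsuc i))

sumℚ : ∀ {n} → (Fin n → ℚ) → ℚ
sumℚ {zero}  f = 0q
sumℚ {suc n} f = f fzero +q sumℚ (λ i → f (fsuc i))

count : ∀ {n} → (Fin n → Bool) → ℕ
count p = sumℕ (λ i → if p i then 1 else 0)

_==_ : ∀ {n} → Fin n → Fin n → Bool
a == b = toℕ a ≡ᵇ toℕ b

-- division on ℚ, with the (never used) convention a / 0 = 0
divq : ℕ → ℕ → ℚ
divq a zero    = 0q
divq a (suc b) = (+ a) / suc b

module _ {n : ℕ} (G : Graph n) where

  deg : Fin n → ℕ
  deg v = count (adj G v)

  prec : Fin n → Fin n → Bool
  prec u v = (deg u <ᵇ deg v) ∨ ((deg u ≡ᵇ deg v) ∧ (toℕ u <ᵇ toℕ v))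

  L : Fin n → Fin n → ℕ
  L u v = count (λ x → adj G u x ∧ prec v x)

  lam : Fin n → Fin n → ℕ
  lam u v = L u v * L v u

  -- each undirected edge counted once, as (u,v) with id u < id v
  isEdgeOrd : Fin n → Fin n → Bool
  isEdgeOrd u v = adj G u v ∧ (toℕ u <ᵇ toℕ v)

  Λ : ℕ
  Λ = sumℕ (λ u → sumℕ (λ v → if isEdgeOrd u v then lam u v else 0))

  Centered : Fin n → Fin n → Fin n → Fin n → Set
  Centered t u v w =
    (t ≢ u) × (t ≢ v) × (t ≢ w) × (u ≢ v) × (u ≢ w) × (v ≢ w) ×
    (adj G t u ≡ true) × (adj G u v ≡ true) × (adj G v w ≡ true) ×
    (prec v t ≡ true) × (prec u w ≡ true) × (adj G t w ≡ true)

-- edge sets of 3-paths, compared as sets of undirected edges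
Edge : ℕ → Set
Edge n = Fin n × Fin n

sameEdge : ∀ {n} → Edge n → Edge n → Bool
sameEdge (a , b) (c , d) = ((a == c) ∧ (b == d)) ∨ ((a == d) ∧ (b == c))

Three : ℕ → Set
Three n = Edge n × Edge n × Edge n

memE : ∀ {n} → Edge n → Three n → Bool
memE e (x , y , z) = sameEdge e x ∨ sameEdge e y ∨ sameEdge e z

subE : ∀ {n} → Three n → Three n → Bool
subE (x , y , z) S = memE x S ∧ memE y S ∧ memE z S

sameSet : ∀ {n} → Three n → Three n → Bool
sameSet S T = subE S T ∧ subE T S

path3 : ∀ {n} → Fin n → Fin n → Fin n → Fin n → Three n
path3 t u v w = ((t , u) , (u , v) , (v , w))

module _ {n : ℕ} (G : Graph n) where

  -- Pr[sample-centered outputs the edge set of the path (t,u,v,w)]: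
  -- sum over all outcomes (e=(u0,v0), u', v') of their probability
  -- (λ_e/Λ)·(1/L_{u0,v0})·(1/L_{v0,u0}) times the indicator that the output equals P.
  probOutput : Fin n → Fin n → Fin n → Fin n → ℚ
  probOutput t u v w =
    sumℚ λ u0 → sumℚ λ v0 →
      if isEdgeOrd G u0 v0 then
        (sumℚ λ u' → sumℚ λ v' →
          if adj G u0 u' ∧ prec G v0 u' ∧ adj G v0 v' ∧ prec G u0 v'
             ∧ sameSet (path3 u' u0 v0 v') (path3 t u v w)
          then divq (lam G u0 v0) (Λ G) *q divq 1 (L G u0 v0) *q divq 1 (L G v0 u0)
          else 0q)
      else 0q

module Submission where

-- Each outcome of sample-centered is a triple (e = (u0,v0), u', v'), drawn with
-- probability (λ_e/Λ)·(1/L_{u0,v0})·(1/L_{v0,u0}) = 1/Λ since λ_e = L_{u0,v0}·L_{v0,u0}.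
-- So it suffices that EXACTLY ONE outcome outputs the edge set of P = t-u-v-w.
--
-- Uniqueness is a fact about the path.  An output u'-u0-v0-v' has u' ≠ v0 and
-- v' ≠ u0 (as v0 ≺ u' and u0 ≺ v'), and its edges lie in P.  The ends t, w have a
-- single P-neighbour, so neither u0 nor v0 is an end; hence {u0,v0} = {u,v} and the
-- outer vertices are forced (path-middle).  Both traversals (u,v,t,w) and (v,u,w,t)
-- output P, but an edge is drawn in one orientation only (id u0 < id v0), so exactly
-- one of them is an outcome.  The quadruple sum defining the probability then
-- collapses to that outcome's weight.

open import Defs
open import Data.Nat using (ℕ; _<_)
open import Data.Fin using (Fin)
open import Relation.Binary.PropositionalEquality using (_≡_)

open import Data.Nat as ℕ using (suc; _*_; _<ᵇ_; z≤n; s≤s)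
import Data.Nat.Properties as ℕP
open import Data.Nat.Tactic.RingSolver using (solve-∀)
open import Data.Fin using (toℕ) renaming (zero to fzero; suc to fsuc)
open import Data.Fin.Properties using (toℕ-injective; suc-injective)
open import Data.Bool using (Bool; true; false; _∧_; _∨_; if_then_else_)
open import Data.Bool.Properties using (T-≡)
open import Data.Integer using (+_)
open import Data.Rational using (ℚ; toℚᵘ) renaming (_*_ to _*q_; _+_ to _+q_; 0ℚ to 0q)
open import Data.Rational.Properties using (toℚᵘ-injective; toℚᵘ-homo-*; toℚᵘ-fromℚᵘ; +-identityˡ; +-identityʳ)
import Data.Rational.Unnormalised as ℚᵘ
import Data.Rational.Unnormalised.Properties as ℚᵘP
open import Data.Product using (_×_; _,_; proj₁; proj₂)
open import Data.Sum using (_⊎_; inj₁; inj₂)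
open import Data.Empty using (⊥; ⊥-elim)
open import Function using (_∘_)
open import Function.Bundles using (Equivalence)
open import Relation.Binary.Definitions using (tri<; tri≈; tri>)
open import Relation.Binary.PropositionalEquality using (_≢_; refl; sym; trans; cong; cong₂; ≢-sym; module ≡-Reasoning)

private
  variable
    n : ℕ

-- The weight of one outcome: (pq/m)·(1/p)·(1/q) = 1/m for positive p, q, m.
-- Computed in unnormalised rationals, where it is a cross-multiplication identity.
outcome-weight : ∀ p q m → 0 < p → 0 < q → 0 < m →
                 divq (p * q) m *q divq 1 p *q divq 1 q ≡ divq 1 m
outcome-weight (suc p) (suc q) (suc m) _ _ _ = toℚᵘ-injective (begin
    toℚᵘ (A *q B *q C)
  ≈⟨ toℚᵘ-homo-* (A *q B) C ⟩
    toℚᵘ (A *q B) ℚᵘ.* toℚᵘ C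
  ≈⟨ ℚᵘP.*-cong (toℚᵘ-homo-* A B) ℚᵘP.≃-refl ⟩
    toℚᵘ A ℚᵘ.* toℚᵘ B ℚᵘ.* toℚᵘ C
  ≈⟨ ℚᵘP.*-cong (ℚᵘP.*-cong (toℚᵘ-fromℚᵘ (ℚᵘ.mkℚᵘ (+ (suc p * suc q)) m))
                             (toℚᵘ-fromℚᵘ (ℚᵘ.mkℚᵘ (+ 1) p)))
                (toℚᵘ-fromℚᵘ (ℚᵘ.mkℚᵘ (+ 1) q)) ⟩
    ℚᵘ.mkℚᵘ (+ (suc p * suc q)) m ℚᵘ.* ℚᵘ.mkℚᵘ (+ 1) p ℚᵘ.* ℚᵘ.mkℚᵘ (+ 1) q
  ≈⟨ ℚᵘ.*≡* (cong +_ (cross-multiplied (suc p) (suc q) (suc m))) ⟩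
    ℚᵘ.mkℚᵘ (+ 1) m
  ≈⟨ toℚᵘ-fromℚᵘ (ℚᵘ.mkℚᵘ (+ 1) m) ⟨
    toℚᵘ (divq 1 (suc m))
  ∎)
  where
  open ℚᵘP.≃-Reasoning
  A = divq (suc p * suc q) (suc m)
  B = divq 1 (suc p)
  C = divq 1 (suc q)
  cross-multiplied : ∀ a b c → ((a * b) * 1 * 1) * c ≡ 1 * (c * a * b)
  cross-multiplied = solve-∀

sumℚ-zero : (f : Fin n → ℚ) → (∀ i → f i ≡ 0q) → sumℚ f ≡ 0q
sumℚ-zero {ℕ.zero}  f f≡0 = refl
sumℚ-zero {suc n} f f≡0 =
  trans (cong₂ _+q_ (f≡0 fzero) (sumℚ-zero (λ i → f (fsuc i)) (λ i → f≡0 (fsuc i))))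
        (+-identityˡ 0q)

sumℚ-single : (f : Fin n → ℚ) (a : Fin n) → (∀ i → i ≢ a → f i ≡ 0q) → sumℚ f ≡ f a
sumℚ-single f fzero off-a =
  trans (cong (f fzero +q_) (sumℚ-zero _ (λ i → off-a (fsuc i) λ ())))
        (+-identityʳ (f fzero))
sumℚ-single f (fsuc a) off-a =
  trans (cong₂ _+q_ (off-a fzero λ ())
                    (sumℚ-single (λ i → f (fsuc i)) a λ i i≢a → off-a (fsuc i) (i≢a ∘ suc-injective)))
        (+-identityˡ (f (fsuc a)))

count-pos : (p : Fin n → Bool) (a : Fin n) → p a ≡ true → 0 < count p
count-pos p fzero pa rewrite pa = s≤s z≤n
count-pos p (fsuc a) pa =
  ℕP.<-≤-trans (count-pos (λ i → p (fsuc i)) a pa) (ℕP.m≤n+m _ (if p fzero then 1 else 0))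

∧-split : ∀ {a b} → a ∧ b ≡ true → a ≡ true × b ≡ true
∧-split {true} b≡true = refl , b≡true

∧-intro : ∀ {a b} → a ≡ true → b ≡ true → a ∧ b ≡ true
∧-intro refl b≡true = b≡true

∨-split : ∀ {a b} → a ∨ b ≡ true → a ≡ true ⊎ b ≡ true
∨-split {true}  _      = inj₁ refl
∨-split {false} b≡true = inj₂ b≡true

∨-introˡ : ∀ {a b} → a ≡ true → a ∨ b ≡ true
∨-introˡ refl = refl

∨-introʳ : ∀ {a b} → b ≡ true → a ∨ b ≡ true
∨-introʳ {true}  _ = refl
∨-introʳ {false} b≡true = b≡true

<ᵇ-sound : ∀ m k → (m <ᵇ k) ≡ true → m < k
<ᵇ-sound m k lt = ℕP.<ᵇ⇒< m k (Equivalence.from T-≡ lt)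

<ᵇ-complete : ∀ {m k} → m < k → (m <ᵇ k) ≡ true
<ᵇ-complete lt = Equivalence.to T-≡ (ℕP.<⇒<ᵇ lt)

==-sound : {a b : Fin n} → a == b ≡ true → a ≡ b
==-sound {a = a} {b} eq = toℕ-injective (ℕP.≡ᵇ⇒≡ (toℕ a) (toℕ b) (Equivalence.from T-≡ eq))

==-refl : (a : Fin n) → a == a ≡ true
==-refl a = Equivalence.to T-≡ (ℕP.≡⇒≡ᵇ (toℕ a) (toℕ a) refl)

if-true : ∀ {A : Set} {b : Bool} {x y : A} → b ≡ true → (if b then x else y) ≡ x
if-true refl = refl

if-not-true : ∀ {A : Set} {b : Bool} {x y : A} → b ≢ true → (if b then x else y) ≡ y
if-not-true {b = true}  b≢true = ⊥-elim (b≢true refl)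
if-not-true {b = false} _      = refl

SameEdge : Edge n → Edge n → Set
SameEdge (a , b) (c , d) = (a ≡ c × b ≡ d) ⊎ (a ≡ d × b ≡ c)

pattern same    eqs = inj₁ eqs
pattern swapped eqs = inj₂ eqs

_∈E_ : Edge n → Three n → Set
e ∈E (x , y , z) = SameEdge e x ⊎ SameEdge e y ⊎ SameEdge e z

pattern first  s = inj₁ s
pattern second s = inj₂ (inj₁ s)
pattern third  s = inj₂ (inj₂ s)

sameEdge-sound : (e f : Edge n) → sameEdge e f ≡ true → SameEdge e f
sameEdge-sound _ _ s with ∨-split s
... | inj₁ c = same    (==-sound (proj₁ (∧-split c)) , ==-sound (proj₂ (∧-split c)))
... | inj₂ c = swapped (==-sound (proj₁ (∧-split c)) , ==-sound (proj₂ (∧-split c)))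

sameEdge-complete : (e f : Edge n) → SameEdge e f → sameEdge e f ≡ true
sameEdge-complete (a , b) _ (same    (refl , refl)) = ∨-introˡ (∧-intro (==-refl a) (==-refl b))
sameEdge-complete (a , b) _ (swapped (refl , refl)) = ∨-introʳ (∧-intro (==-refl a) (==-refl b))

memE-sound : (e : Edge n) (S : Three n) → memE e S ≡ true → e ∈E S
memE-sound e (x , y , z) m with ∨-split m
... | inj₁ s = first (sameEdge-sound e x s)
... | inj₂ m' with ∨-split m'
...   | inj₁ s = second (sameEdge-sound e y s)
...   | inj₂ s = third  (sameEdge-sound e z s)

memE-complete : (e : Edge n) (S : Three n) → e ∈E S → memE e S ≡ true
memE-complete e (x , y , z) (first s)  = ∨-introˡ (sameEdge-complete e x s)
memE-complete e (x , y , z) (second s) =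
  ∨-introʳ {sameEdge e x} (∨-introˡ {sameEdge e y} (sameEdge-complete e y s))
memE-complete e (x , y , z) (third s)  =
  ∨-introʳ {sameEdge e x} (∨-introʳ {sameEdge e y} (sameEdge-complete e z s))

∈E-flip : ∀ {a b : Fin n} {S : Three n} → (a , b) ∈E S → (b , a) ∈E S
∈E-flip {S = _ , _ , _} = flip-all
  where
  flip : ∀ {a b c d : Fin n} → SameEdge (a , b) (c , d) → SameEdge (b , a) (c , d)
  flip (same    (a≡c , b≡d)) = swapped (b≡d , a≡c)
  flip (swapped (a≡d , b≡c)) = same    (b≡c , a≡d)
  flip-all : ∀ {a b} {x y z : Edge n} → (a , b) ∈E (x , y , z) → (b , a) ∈E (x , y , z)
  flip-all {x = _ , _} (first s)  = first (flip s)
  flip-all {y = _ , _} (second s) = second (flip s)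
  flip-all {z = _ , _} (third s)  = third (flip s)

subE-sound : (x y z : Edge n) (T : Three n) → subE (x , y , z) T ≡ true →
             x ∈E T × y ∈E T × z ∈E T
subE-sound x y z T s =
  memE-sound x T (proj₁ s₁) , memE-sound y T (proj₁ s₂) , memE-sound z T (proj₂ s₂)
  where
  s₁ = ∧-split s
  s₂ = ∧-split (proj₂ s₁)

subE-complete : (x y z : Edge n) (T : Three n) → x ∈E T → y ∈E T → z ∈E T →
                subE (x , y , z) T ≡ true
subE-complete x y z T x∈ y∈ z∈ =
  ∧-intro (memE-complete x T x∈) (∧-intro (memE-complete y T y∈) (memE-complete z T z∈))

path3-reverse : (t u v w : Fin n) → sameSet (path3 w v u t) (path3 t u v w) ≡ true
path3-reverse t u v w =
  ∧-intro (subE-complete (w , v) (v , u) (u , t) (path3 t u v w)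
             (third (swapped (refl , refl))) (second (swapped (refl , refl))) (first (swapped (refl , refl))))
          (subE-complete (t , u) (u , v) (v , w) (path3 w v u t)
             (third (swapped (refl , refl))) (second (swapped (refl , refl))) (first (swapped (refl , refl))))

path3-refl : (t u v w : Fin n) → sameSet (path3 t u v w) (path3 t u v w) ≡ true
path3-refl t u v w = ∧-intro both both
  where
  both : subE (path3 t u v w) (path3 t u v w) ≡ true
  both = subE-complete (t , u) (u , v) (v , w) (path3 t u v w)
           (first (same (refl , refl))) (second (same (refl , refl))) (third (same (refl , refl)))

module PathNeighbours {t u v w : Fin n}
  (t≢u : t ≢ u) (t≢v : t ≢ v) (t≢w : t ≢ w) (u≢v : u ≢ v) (u≢w : u ≢ w) (v≢w : v ≢ w) where

  P : Three n
  P = path3 t u v w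

  leaf-t : ∀ {a} → (a , t) ∈E P → a ≡ u
  leaf-t (first  (same    (_ , t≡u)))   = ⊥-elim (t≢u t≡u)
  leaf-t (first  (swapped (a≡u , _)))   = a≡u
  leaf-t (second (same    (_ , t≡v)))   = ⊥-elim (t≢v t≡v)
  leaf-t (second (swapped (_ , t≡u)))   = ⊥-elim (t≢u t≡u)
  leaf-t (third  (same    (_ , t≡w)))   = ⊥-elim (t≢w t≡w)
  leaf-t (third  (swapped (_ , t≡v)))   = ⊥-elim (t≢v t≡v)

  leaf-w : ∀ {a} → (a , w) ∈E P → a ≡ v
  leaf-w (first  (same    (_ , w≡u)))   = ⊥-elim (u≢w (sym w≡u))
  leaf-w (first  (swapped (_ , w≡t)))   = ⊥-elim (t≢w (sym w≡t))
  leaf-w (second (same    (_ , w≡v)))   = ⊥-elim (v≢w (sym w≡v))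
  leaf-w (second (swapped (_ , w≡u)))   = ⊥-elim (u≢w (sym w≡u))
  leaf-w (third  (same    (a≡v , _)))   = a≡v
  leaf-w (third  (swapped (_ , w≡v)))   = ⊥-elim (v≢w (sym w≡v))

  inner-u : ∀ {a} → (a , u) ∈E P → a ≢ v → a ≡ t
  inner-u (first  (same    (a≡t , _)))  _   = a≡t
  inner-u (first  (swapped (_ , u≡t)))  _   = ⊥-elim (t≢u (sym u≡t))
  inner-u (second (same    (_ , u≡v)))  _   = ⊥-elim (u≢v u≡v)
  inner-u (second (swapped (a≡v , _)))  a≢v = ⊥-elim (a≢v a≡v)
  inner-u (third  (same    (_ , u≡w)))  _   = ⊥-elim (u≢w u≡w)
  inner-u (third  (swapped (_ , u≡v)))  _   = ⊥-elim (u≢v u≡v)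

  inner-v : ∀ {a} → (a , v) ∈E P → a ≢ u → a ≡ w
  inner-v (first  (same    (_ , v≡u)))  _   = ⊥-elim (u≢v (sym v≡u))
  inner-v (first  (swapped (_ , v≡t)))  _   = ⊥-elim (t≢v (sym v≡t))
  inner-v (second (same    (a≡u , _)))  a≢u = ⊥-elim (a≢u a≡u)
  inner-v (second (swapped (_ , v≡u)))  _   = ⊥-elim (u≢v (sym v≡u))
  inner-v (third  (same    (_ , v≡w)))  _   = ⊥-elim (v≢w v≡w)
  inner-v (third  (swapped (a≡w , _)))  _   = a≡w

  path-middle : ∀ {x a b y} → (x , a) ∈E P → (a , b) ∈E P → (b , y) ∈E P → x ≢ b → y ≢ a →
                (a ≡ u × b ≡ v × x ≡ t × y ≡ w) ⊎ (a ≡ v × b ≡ u × x ≡ w × y ≡ t)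
  path-middle xa (first  (same    (refl , refl))) by x≢b y≢a = ⊥-elim (x≢b (leaf-t xa))
  path-middle xa (first  (swapped (refl , refl))) by x≢b y≢a = ⊥-elim (y≢a (leaf-t (∈E-flip by)))
  path-middle xa (second (same    (refl , refl))) by x≢b y≢a =
    inj₁ (refl , refl , inner-u xa x≢b , inner-v (∈E-flip by) y≢a)
  path-middle xa (second (swapped (refl , refl))) by x≢b y≢a =
    inj₂ (refl , refl , inner-v xa x≢b , inner-u (∈E-flip by) y≢a)
  path-middle xa (third  (same    (refl , refl))) by x≢b y≢a = ⊥-elim (y≢a (leaf-w (∈E-flip by)))
  path-middle xa (third  (swapped (refl , refl))) by x≢b y≢a = ⊥-elim (x≢b (leaf-w xa))

prec⇒≢ : (G : Graph n) {a b : Fin n} → prec G a b ≡ true → a ≢ b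
prec⇒≢ G {a} p refl with ∨-split {deg G a <ᵇ deg G a} p
... | inj₁ deg<deg = ℕP.<-irrefl refl (<ᵇ-sound (deg G a) (deg G a) deg<deg)
... | inj₂ ties    = ℕP.<-irrefl refl (<ᵇ-sound (toℕ a) (toℕ a) (proj₂ (∧-split {deg G a ℕ.≡ᵇ deg G a} ties)))

isEdgeOrd-asym : (G : Graph n) {a b : Fin n} → isEdgeOrd G a b ≡ true → isEdgeOrd G b a ≡ true → ⊥
isEdgeOrd-asym G {a} {b} ab ba =
  ℕP.<-asym (<ᵇ-sound (toℕ a) (toℕ b) (proj₂ (∧-split {adj G a b} ab)))
            (<ᵇ-sound (toℕ b) (toℕ a) (proj₂ (∧-split {adj G b a} ba)))

module Sampling (G : Graph n) (t u v w : Fin n) where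

  Hits : Fin n → Fin n → Fin n → Fin n → Bool
  Hits u0 v0 u' v' = adj G u0 u' ∧ prec G v0 u' ∧ adj G v0 v' ∧ prec G u0 v'
                     ∧ sameSet (path3 u' u0 v0 v') (path3 t u v w)

  record Hit (u0 v0 u' v' : Fin n) : Set where
    field
      adj-u0u'   : adj G u0 u' ≡ true
      prec-v0u'  : prec G v0 u' ≡ true
      adj-v0v'   : adj G v0 v' ≡ true
      prec-u0v'  : prec G u0 v' ≡ true
      same-edges : sameSet (path3 u' u0 v0 v') (path3 t u v w) ≡ true

  hit-sound : ∀ {u0 v0 u' v'} → Hits u0 v0 u' v' ≡ true → Hit u0 v0 u' v'
  hit-sound {u0} {v0} {u'} {v'} h = record
    { adj-u0u' = proj₁ h₁ ; prec-v0u' = proj₁ h₂ ; adj-v0v' = proj₁ h₃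
    ; prec-u0v' = proj₁ h₄ ; same-edges = proj₂ h₄ }
    where
    h₁ = ∧-split {adj G u0 u'} h
    h₂ = ∧-split {prec G v0 u'} (proj₂ h₁)
    h₃ = ∧-split {adj G v0 v'} (proj₂ h₂)
    h₄ = ∧-split {prec G u0 v'} (proj₂ h₃)

  hit-complete : ∀ {u0 v0 u' v'} → Hit u0 v0 u' v' → Hits u0 v0 u' v' ≡ true
  hit-complete h = ∧-intro adj-u0u' (∧-intro prec-v0u' (∧-intro adj-v0v' (∧-intro prec-u0v' same-edges)))
    where open Hit h

  weight : Fin n → Fin n → ℚ
  weight u0 v0 = divq (lam G u0 v0) (Λ G) *q divq 1 (L G u0 v0) *q divq 1 (L G v0 u0)

  edge-mass : Fin n → Fin n → ℚ
  edge-mass u0 v0 =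
    if isEdgeOrd G u0 v0
    then (sumℚ λ u' → sumℚ λ v' → if Hits u0 v0 u' v' then weight u0 v0 else 0q)
    else 0q

  OnlyHit : Fin n → Fin n → Fin n → Fin n → Set
  OnlyHit a b x y = ∀ u0 v0 u' v' → isEdgeOrd G u0 v0 ≡ true → Hits u0 v0 u' v' ≡ true →
                    u0 ≡ a × v0 ≡ b × u' ≡ x × v' ≡ y

  probOutput-single : ∀ {a b x y} → OnlyHit a b x y →
                      isEdgeOrd G a b ≡ true → Hits a b x y ≡ true → probOutput G t u v w ≡ weight a b
  probOutput-single {a} {b} {x} {y} only edge-ab hit = begin
      sumℚ (λ u0 → sumℚ λ v0 → edge-mass u0 v0)
    ≡⟨ sumℚ-single _ a (λ u0 u0≢a → sumℚ-zero _ λ v0 → no-mass u0 v0 (u0≢a ∘ proj₁)) ⟩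
      sumℚ (λ v0 → edge-mass a v0)
    ≡⟨ sumℚ-single _ b (λ v0 v0≢b → no-mass a v0 (v0≢b ∘ proj₂)) ⟩
      edge-mass a b
    ≡⟨ if-true edge-ab ⟩
      (sumℚ λ u' → sumℚ λ v' → if Hits a b u' v' then weight a b else 0q)
    ≡⟨ sumℚ-single _ x (λ u' u'≢x → sumℚ-zero _ λ v' →
         if-not-true λ h → u'≢x (proj₁ (proj₂ (proj₂ (only a b u' v' edge-ab h))))) ⟩
      (sumℚ λ v' → if Hits a b x v' then weight a b else 0q)
    ≡⟨ sumℚ-single _ y (λ v' v'≢y →
         if-not-true λ h → v'≢y (proj₂ (proj₂ (proj₂ (only a b x v' edge-ab h))))) ⟩
      (if Hits a b x y then weight a b else 0q)
    ≡⟨ if-true hit ⟩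
      weight a b
    ∎
    where
    open ≡-Reasoning
    no-mass : ∀ u0 v0 → (u0 ≡ a × v0 ≡ b → ⊥) → edge-mass u0 v0 ≡ 0q
    no-mass u0 v0 not-ab with isEdgeOrd G u0 v0 in edge
    ... | false = refl
    ... | true  = sumℚ-zero _ λ u' → sumℚ-zero _ λ v' → if-not-true λ h →
                    let (u0≡a , v0≡b , _) = only u0 v0 u' v' edge h in not-ab (u0≡a , v0≡b)

  -- A hitting outcome witnesses L_{a,b} > 0 (by x) and L_{b,a} > 0 (by y), so its
  -- weight is 1/Λ.
  hit-weight : ∀ {a b x y} → 0 < Λ G → Hits a b x y ≡ true → weight a b ≡ divq 1 (Λ G)
  hit-weight {a} {b} {x} {y} Λ>0 hit =
    outcome-weight (L G a b) (L G b a) (Λ G)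
      (count-pos (λ z → adj G a z ∧ prec G b z) x (∧-intro adj-u0u' prec-v0u'))
      (count-pos (λ z → adj G b z ∧ prec G a z) y (∧-intro adj-v0v' prec-u0v'))
      Λ>0
    where open Hit (hit-sound hit)

  module _ (t≢u : t ≢ u) (t≢v : t ≢ v) (t≢w : t ≢ w) (u≢v : u ≢ v) (u≢w : u ≢ w) (v≢w : v ≢ w) where

    open PathNeighbours t≢u t≢v t≢w u≢v u≢w v≢w

    hit-traverses : ∀ {u0 v0 u' v'} → Hits u0 v0 u' v' ≡ true →
                    (u0 ≡ u × v0 ≡ v × u' ≡ t × v' ≡ w) ⊎ (u0 ≡ v × v0 ≡ u × u' ≡ w × v' ≡ t)
    hit-traverses {u0} {v0} {u'} {v'} hit =
      path-middle u'u0∈P u0v0∈P v0v'∈P (≢-sym (prec⇒≢ G prec-v0u')) (≢-sym (prec⇒≢ G prec-u0v'))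
      where
      open Hit (hit-sound hit)
      edges = subE-sound (u' , u0) (u0 , v0) (v0 , v') P
                (proj₁ (∧-split {subE (path3 u' u0 v0 v') P} same-edges))
      u'u0∈P = proj₁ edges
      u0v0∈P = proj₁ (proj₂ edges)
      v0v'∈P = proj₂ (proj₂ edges)

    -- The two traversals use opposite orientations of the edge uv, and only one
    -- orientation can be drawn; so a drawable hitting outcome is the only one.
    hit-unique : ∀ {a b x y} → isEdgeOrd G a b ≡ true → Hits a b x y ≡ true → OnlyHit a b x y
    hit-unique edge-ab hit-ab u0 v0 u' v' edge hit with hit-traverses hit-ab | hit-traverses hit
    ... | inj₁ (refl , refl , refl , refl) | inj₁ (refl , refl , refl , refl) = refl , refl , refl , refl
    ... | inj₂ (refl , refl , refl , refl) | inj₂ (refl , refl , refl , refl) = refl , refl , refl , refl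
    ... | inj₁ (refl , refl , _ , _) | inj₂ (refl , refl , _ , _) = ⊥-elim (isEdgeOrd-asym G edge-ab edge)
    ... | inj₂ (refl , refl , _ , _) | inj₁ (refl , refl , _ , _) = ⊥-elim (isEdgeOrd-asym G edge-ab edge)

    single-hit-probability : ∀ {a b x y} → 0 < Λ G → isEdgeOrd G a b ≡ true → Hits a b x y ≡ true →
                             probOutput G t u v w ≡ divq 1 (Λ G)
    single-hit-probability Λ>0 edge-ab hit =
      trans (probOutput-single (hit-unique edge-ab hit) edge-ab hit) (hit-weight Λ>0 hit)

-- Main theorem: the outcome traversing P along the id-orientation of its middle edge
-- uv is drawable and outputs P, so P is output with probability exactly 1/Λ.
claim2 : (n : ℕ) (G : Graph n) → 0 < Λ G →
    (t u v w : Fin n) → Centered G t u v w →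
    probOutput G t u v w ≡ divq 1 (Λ G)
claim2 n G Λ>0 t u v w (t≢u , t≢v , t≢w , u≢v , u≢w , v≢w , adj-tu , adj-uv , adj-vw , v≺t , u≺w , _)
  with ℕP.<-cmp (toℕ u) (toℕ v)
... | tri< u<v _ _ = single-hit-probability t≢u t≢v t≢w u≢v u≢w v≢w Λ>0
                       (∧-intro adj-uv (<ᵇ-complete u<v)) forward
  where
  open Sampling G t u v w
  forward : Hits u v t w ≡ true
  forward = hit-complete record
    { adj-u0u' = trans (adj-sym G u t) adj-tu ; prec-v0u' = v≺t ; adj-v0v' = adj-vw
    ; prec-u0v' = u≺w ; same-edges = path3-refl t u v w }
... | tri≈ _ u≡v _ = ⊥-elim (u≢v (toℕ-injective u≡v))
... | tri> _ _ v<u = single-hit-probability t≢u t≢v t≢w u≢v u≢w v≢w Λ>0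
                       (∧-intro (trans (adj-sym G v u) adj-uv) (<ᵇ-complete v<u)) backward
  where
  open Sampling G t u v w
  backward : Hits v u w t ≡ true
  backward = hit-complete record
    { adj-u0u' = adj-vw ; prec-v0u' = u≺w ; adj-v0v' = trans (adj-sym G u t) adj-tu
    ; prec-u0v' = v≺t ; same-edges = path3-reverse t u v w }
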